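{- Let $G=(V,E)$ be a graph. Every lossless translation on $G$ is an isometry of $G$.
   Context: A graph $G=(V,E)$ is finite, simple and undirected; $d(v_1,v_2)$ denotes the geodesic (shortest-path) distance, equal to $+\infty$ if no path exists. Let $\bot$ be a symbol not in $V$. A transformation on $G$ is a map $\phi : V\cup\{\bot\} \to V \cup\{\bot\}$ with $\phi(\bot)=\bot$ that is injective on $V_{\not\bot} := \{v \in V : \phi(v) \neq \bot\}$; it is lossless if $\phi(v)\ne\bot$ for all $v\in V$. It is edge-constrained (EC) if $\{v,\phi(v)\} \in E$ for all $v \in V_{\not\bot}$, and strongly neighborhood-preserving (SNP) if for all $v_1,v_2 \in V_{\not\bot}$: $\{v_1,v_2\}\in E \Leftrightarrow \{\phi(v_1),\phi(v_2)\} \in E$. A translation is an EC and SNP transformation. A transformation is an isometry if $d(v_1,v_2)=d(\phi(v_1),\phi(v_2))$ for all $v_1,v_2\in V_{\not\bot}$. -}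

module Defs where

open import Data.Nat using (ℕ; zero; suc)
open import Data.Fin using (Fin)
open import Data.Fin.Properties using (_≟_)
open import Data.Bool using (Bool; true; false; _∧_; if_then_else_)
open import Data.Maybe using (Maybe; just; nothing)
open import Data.List using (List)
open import Data.Bool.ListAction using (any)
open import Data.List using () renaming (allFin to allFinL)
open import Relation.Nullary.Decidable using (⌊_⌋)
open import Relation.Binary.PropositionalEquality using (_≡_; _≢_)

record Graph : Set where
  field
    n       : ℕ
    adj     : Fin n → Fin n → Bool
    sym     : ∀ u v → adj u v ≡ adj v u
    irrefl  : ∀ v → adj v v ≡ false

open Graph public

V : Graph → Set
V G = Fin (n G)

V⊥ : Graph → Set
V⊥ G = Maybe (V G)

walkB : (G : Graph) → ℕ → V G → V G → Bool
walkB G zero    u v = ⌊ u ≟ v ⌋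
walkB G (suc k) u v = any (λ w → adj G u w ∧ walkB G k w v) (allFinL (n G))

-- ℕ ∪ {+∞}: nothing denotes +∞.
ℕ∞ : Set
ℕ∞ = Maybe ℕ

search : (G : Graph) → V G → V G → ℕ → ℕ → ℕ∞
search G u v k zero       = nothing
search G u v k (suc fuel) =
  if walkB G k u v then just k else search G u v (suc k) fuel

-- A shortest path has length < n, so searching lengths
-- 0 .. n-1 suffices; if none exists the distance is +∞ (nothing).
dist : (G : Graph) → V G → V G → ℕ∞
dist G u v = search G u v zero (n G)

record Transformation (G : Graph) : Set where
  field
    φ      : V⊥ G → V⊥ G
    φ-⊥    : φ nothing ≡ nothing
    inj    : ∀ (v₁ v₂ : V G) (w : V G) →
             φ (just v₁) ≡ just w → φ (just v₂) ≡ just w → v₁ ≡ v₂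

open Transformation public

Lossless : {G : Graph} → Transformation G → Set
Lossless {G} T = ∀ (v : V G) → φ T (just v) ≢ nothing

EdgeConstrained : {G : Graph} → Transformation G → Set
EdgeConstrained {G} T = ∀ (v w : V G) → φ T (just v) ≡ just w → adj G v w ≡ true

SNP : {G : Graph} → Transformation G → Set
SNP {G} T = ∀ (v₁ v₂ w₁ w₂ : V G) →
  φ T (just v₁) ≡ just w₁ → φ T (just v₂) ≡ just w₂ →
  adj G v₁ v₂ ≡ adj G w₁ w₂

Translation : {G : Graph} → Transformation G → Set
Translation T = EdgeConstrained T × SNP T
  where open import Data.Product using (_×_)

Isometry : {G : Graph} → Transformation G → Set
Isometry {G} T = ∀ (v₁ v₂ w₁ w₂ : V G) →
  φ T (just v₁) ≡ just w₁ → φ T (just v₂) ≡ just w₂ →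
  dist G v₁ v₂ ≡ dist G w₁ w₂

{-# OPTIONS --safe #-}
-- A lossless transformation restricts to an injective, hence bijective, map f on the finite
-- vertex set, and the strong neighbourhood property says adj u v ≡ adj (f u) (f v): f is a
-- graph automorphism.  Reindexing the intermediate vertex of a walk along the bijection f
-- shows that walks of each length from u to v and from f u to f v exist together, so the
-- least such length, i.e. the distance, is preserved.
module Submission where

open import Defs hiding (sym; inj)
open import Data.Bool using (Bool; T; _∧_)
open import Data.Bool.ListAction using (any; or)
open import Data.Empty using (⊥-elim)
open import Data.Fin using (Fin; punchOut)
open import Data.Fin.Properties using (_≟_; any?; punchOut-injective; <⇒notInjective)
open import Data.List using (allFin)
open import Data.List.Properties using (map-cong)
open import Data.List.Membership.Propositional using (lose)
open import Data.List.Membership.Propositional.Properties using (∈-allFin)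
open import Data.List.Relation.Unary.Any using (satisfied)
open import Data.List.Relation.Unary.Any.Properties using (any⁺; any⁻)
open import Data.Maybe using (Maybe; just; nothing)
open import Data.Maybe.Properties using (just-injective)
open import Data.Nat using (zero; suc)
open import Data.Nat.Properties using (n<1+n)
open import Data.Product using (∃; _,_; proj₁; proj₂)
open import Function using (_∘_)
open import Function.Bundles using (_⇔_; mk⇔)
open import Function.Definitions using (Injective; StrictlySurjective)
open import Function.Properties.Equivalence using () renaming (trans to ⇔-trans; sym to ⇔-sym)
open import Relation.Nullary using (yes; no; does; T?)
open import Relation.Nullary.Decidable using (isYes; isYes≗does; does-⇔)
open import Relation.Binary.PropositionalEquality
open ≡-Reasoning

T-injective : ∀ {b c : Bool} → T b ⇔ T c → b ≡ c
T-injective {b} {c} b⇔c = does-⇔ b⇔c (T? b) (T? c)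

≢nothing⇒just : ∀ {A : Set} (m : Maybe A) → m ≢ nothing → ∃ λ a → m ≡ just a
≢nothing⇒just (just a) _         = a , refl
≢nothing⇒just nothing  m≢nothing = ⊥-elim (m≢nothing refl)

injective⇒strictlySurjective : ∀ {m} {f : Fin m → Fin m} →
  Injective _≡_ _≡_ f → StrictlySurjective _≡_ f
injective⇒strictlySurjective {zero}  _     ()
injective⇒strictlySurjective {suc m} {f} f-inj y with any? (λ x → f x ≟ y)
... | yes hit = hit
... | no miss = ⊥-elim (<⇒notInjective (n<1+n m) avoid-y-injective)
  where
    y∉image : ∀ x → y ≢ f x
    y∉image x y≡fx = miss (x , sym y≡fx)

    avoid-y : Fin (suc m) → Fin m
    avoid-y x = punchOut (y∉image x)

    avoid-y-injective : Injective _≡_ _≡_ avoid-y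
    avoid-y-injective = f-inj ∘ punchOut-injective (y∉image _) (y∉image _)

T-any-allFin : ∀ {n} (P : Fin n → Bool) → T (any P (allFin n)) ⇔ ∃ (T ∘ P)
T-any-allFin {n} P =
  mk⇔ (satisfied ∘ any⁻ P (allFin n)) (λ (i , Pi) → any⁺ P (lose (∈-allFin i) Pi))

any-allFin-reindex : ∀ {n} {f : Fin n → Fin n} → StrictlySurjective _≡_ f →
  (P : Fin n → Bool) → any P (allFin n) ≡ any (P ∘ f) (allFin n)
any-allFin-reindex {f = f} f-surj P =
  T-injective (⇔-trans (T-any-allFin P)
              (⇔-trans (mk⇔ pull push) (⇔-sym (T-any-allFin (P ∘ f)))))
  where
    pull : ∃ (T ∘ P) → ∃ (T ∘ P ∘ f)
    pull (i , Pi) with f-surj i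
    ... | x , refl = x , Pi

    push : ∃ (T ∘ P ∘ f) → ∃ (T ∘ P)
    push (x , Pfx) = f x , Pfx

module Automorphism (G : Graph) (f : V G → V G)
  (f-injective : Injective _≡_ _≡_ f)
  (f-adj : ∀ u v → adj G u v ≡ adj G (f u) (f v)) where

  walkB-preserved : ∀ k u v → walkB G k u v ≡ walkB G k (f u) (f v)
  walkB-preserved zero    u v = begin
    isYes (u ≟ v)     ≡⟨ isYes≗does _ ⟩
    does (u ≟ v)      ≡⟨ does-⇔ (mk⇔ (cong f) f-injective) (u ≟ v) (f u ≟ f v) ⟩
    does (f u ≟ f v)  ≡⟨ isYes≗does _ ⟨
    isYes (f u ≟ f v) ∎
  walkB-preserved (suc k) u v = begin
    walkB G (suc k) u v
      ≡⟨ cong or (map-cong (λ w → cong₂ _∧_ (f-adj u w) (walkB-preserved k w v)) (allFin (n G))) ⟩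
    any (λ w → adj G (f u) (f w) ∧ walkB G k (f w) (f v)) (allFin (n G))
      ≡⟨ any-allFin-reindex (injective⇒strictlySurjective f-injective) _ ⟨
    walkB G (suc k) (f u) (f v) ∎

  search-preserved : ∀ u v k fuel → search G u v k fuel ≡ search G (f u) (f v) k fuel
  search-preserved u v k zero = refl
  search-preserved u v k (suc fuel)
    rewrite walkB-preserved k u v | search-preserved u v (suc k) fuel = refl

  dist-preserved : ∀ u v → dist G u v ≡ dist G (f u) (f v)
  dist-preserved u v = search-preserved u v zero (n G)

module VertexMap {G : Graph} (τ : Transformation G) (lossless : Lossless τ) where

  vertexMap : V G → V G
  vertexMap v = proj₁ (≢nothing⇒just (φ τ (just v)) (lossless v))

  φ-just : ∀ v → φ τ (just v) ≡ just (vertexMap v)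
  φ-just v = proj₂ (≢nothing⇒just (φ τ (just v)) (lossless v))

  φ-just⇒vertexMap : ∀ {v w} → φ τ (just v) ≡ just w → vertexMap v ≡ w
  φ-just⇒vertexMap {v} φv≡w = just-injective (trans (sym (φ-just v)) φv≡w)

  vertexMap-injective : Injective _≡_ _≡_ vertexMap
  vertexMap-injective {v₁} {v₂} fv₁≡fv₂ =
    Transformation.inj τ v₁ v₂ (vertexMap v₂) (trans (φ-just v₁) (cong just fv₁≡fv₂)) (φ-just v₂)

  vertexMap-adj : SNP τ → ∀ u v → adj G u v ≡ adj G (vertexMap u) (vertexMap v)
  vertexMap-adj snp u v = snp u v _ _ (φ-just u) (φ-just v)

corollary1 : (G : Graph) (T : Transformation G) →
    Lossless T → Translation T → Isometry T
corollary1 G τ lossless (_ , snp) v₁ v₂ w₁ w₂ φv₁≡w₁ φv₂≡w₂ = begin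
  dist G v₁ v₂
    ≡⟨ dist-preserved v₁ v₂ ⟩
  dist G (vertexMap v₁) (vertexMap v₂)
    ≡⟨ cong₂ (dist G) (φ-just⇒vertexMap φv₁≡w₁) (φ-just⇒vertexMap φv₂≡w₂) ⟩
  dist G w₁ w₂ ∎
  where
    open VertexMap τ lossless
    open Automorphism G vertexMap vertexMap-injective (vertexMap-adj snp)
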